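{- For each $n\geq0$, the partially ordered set $\mathcal{L}_n^*$ is a distributive lattice.
   Context: Games are finite partizan games; sum $G+H=\{G^L+H,G+H^L\mid G^R+H,G+H^R\}$; $0=\{\cdot\mid\cdot\}$. Misère outcomes: $o^L(G)=\mathscr{L}$ iff $G$ has no Left option or some $o^R(G^L)=\mathscr{L}$ (else $\mathscr{R}$); $o^R(G)=\mathscr{R}$ iff $G$ has no Right option or some $o^L(G^R)=\mathscr{R}$ (else $\mathscr{L}$); $o(G)=\mathscr{L},\mathscr{N},\mathscr{P},\mathscr{R}$ for $(o^L,o^R)=(\mathscr{L},\mathscr{L}),(\mathscr{L},\mathscr{R}),(\mathscr{R},\mathscr{L}),(\mathscr{R},\mathscr{R})$, ordered $\mathscr{L}>\mathscr{N}>\mathscr{R}$, $\mathscr{L}>\mathscr{P}>\mathscr{R}$. For Left dead-ends (games all of whose subpositions have no Left option), $G\geq H$ means $o(G+X)\geq o(H+X)$ for all games $X$, and $G=H$ means $G\geq H\geq G$. The birthday of a Left dead-end $G$ is the minimum height of the game tree of a Left dead-end $K$ with $K=G$. $\mathcal{L}_n$ is the set of equivalence classes (under $=$) of Left dead-ends of birthday $\leq n$, partially ordered by $\geq$; $\mathcal{L}_n^\times=\mathcal{L}_n\setminus\{0\}$; $\mathcal{L}_n^*=\mathcal{L}_n^\times\cup\{\triangledown\}$ where $\triangledown$ is a new element with $\triangledown\geq G$ for all $G\in\mathcal{L}_n^\times$. -}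

module Defs where

open import Data.Nat using (ℕ; zero; suc; _≤_; _⊔_)
open import Data.Nat.Base using () renaming (_+_ to _+ℕ_)
open import Data.Fin using (Fin; splitAt)
open import Data.Bool using (Bool; true; false; not; _∨_)
open import Data.Sum using (_⊎_; inj₁; inj₂; [_,_]′)
open import Data.Product using (Σ; _×_; _,_; ∃)
open import Data.Empty using (⊥)
open import Data.Unit using (⊤)
open import Relation.Nullary using (¬_)
open import Relation.Binary.PropositionalEquality using (_≡_)

data Game : Set where
  ⟨_,_∣_,_⟩ : (nL : ℕ) → (Fin nL → Game) → (nR : ℕ) → (Fin nR → Game) → Game

𝟘 : Game
𝟘 = ⟨ 0 , (λ ()) ∣ 0 , (λ ()) ⟩

-- Disjunctive sum  G + H = { G^L + H , G + H^L | G^R + H , G + H^R }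
infixl 6 _+_

_⊕_ : ∀ {a c} {X : Set} → (Fin a → X) → (Fin c → X) → Fin (a +ℕ c) → X
_⊕_ {a} f h i = [ f , h ]′ (splitAt a i)

_+_ : Game → Game → Game
⟨ a , f ∣ b , g ⟩ + ⟨ c , h ∣ d , k ⟩ =
  ⟨ a +ℕ c , (λ i → f i + ⟨ c , h ∣ d , k ⟩) ⊕ (λ i → ⟨ a , f ∣ b , g ⟩ + h i)
  ∣ b +ℕ d , (λ j → g j + ⟨ c , h ∣ d , k ⟩) ⊕ (λ j → ⟨ a , f ∣ b , g ⟩ + k j) ⟩

data Player : Set where
  𝓛 𝓡 : Player

isZero : ℕ → Bool
isZero zero    = true
isZero (suc _) = false

anyFin : (n : ℕ) → (Fin n → Bool) → Bool
anyFin zero    p = false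
anyFin (suc n) p = p Fin.zero ∨ anyFin n (λ i → p (Fin.suc i))

playerOf : Bool → Player → Player → Player
playerOf true  x _ = x
playerOf false _ y = y

mutual
  oL : Game → Player
  oL ⟨ a , f ∣ b , g ⟩ =
    playerOf (isZero a ∨ anyFin a (λ i → isL (oR (f i)))) 𝓛 𝓡

  oR : Game → Player
  oR ⟨ a , f ∣ b , g ⟩ =
    playerOf (isZero b ∨ anyFin b (λ j → isR (oL (g j)))) 𝓡 𝓛

  isL : Player → Bool
  isL 𝓛 = true
  isL 𝓡 = false

  isR : Player → Bool
  isR 𝓛 = false
  isR 𝓡 = true

data Outcome : Set where
  L N P R : Outcome

outcomeOf : Player → Player → Outcome
outcomeOf 𝓛 𝓛 = L
outcomeOf 𝓛 𝓡 = N
outcomeOf 𝓡 𝓛 = P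
outcomeOf 𝓡 𝓡 = R

o : Game → Outcome
o G = outcomeOf (oL G) (oR G)

infix 4 _≥ₒ_
_≥ₒ_ : Outcome → Outcome → Set
L ≥ₒ _ = ⊤
N ≥ₒ N = ⊤
N ≥ₒ R = ⊤
P ≥ₒ P = ⊤
P ≥ₒ R = ⊤
R ≥ₒ R = ⊤
_ ≥ₒ _ = ⊥

data LeftDeadEnd : Game → Set where
  deadEnd : ∀ {nR} {g : Fin nR → Game} {f : Fin 0 → Game} →
            (∀ j → LeftDeadEnd (g j)) → LeftDeadEnd ⟨ 0 , f ∣ nR , g ⟩

infix 4 _≥_ _≡ᵍ_
_≥_ : Game → Game → Set
G ≥ H = ∀ (X : Game) → o (G + X) ≥ₒ o (H + X)

_≡ᵍ_ : Game → Game → Set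
G ≡ᵍ H = (G ≥ H) × (H ≥ G)

maxFin : (n : ℕ) → (Fin n → ℕ) → ℕ
maxFin zero    h = 0
maxFin (suc n) h = h Fin.zero ⊔ maxFin n (λ i → h (Fin.suc i))

height : Game → ℕ
height ⟨ zero , f ∣ zero , g ⟩ = 0
height ⟨ a , f ∣ b , g ⟩ = suc (maxFin a (λ i → height (f i)) ⊔ maxFin b (λ j → height (g j)))

-- A Left dead-end G has birthday ≤ n iff some Left dead-end K with K = G
-- has game tree of height ≤ n (birthday = minimum such height).
BirthdayLE : Game → ℕ → Set
BirthdayLE G n = Σ Game λ K → LeftDeadEnd K × (K ≡ᵍ G) × (height K ≤ n)

-- 𝓛ₙ as a setoid: Left dead-ends of birthday ≤ n, up to =.

record DeadEndB (n : ℕ) : Set where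
  constructor elt
  field
    game     : Game
    deadend  : LeftDeadEnd game
    birthday : BirthdayLE game n
open DeadEndB public

data 𝓛* (n : ℕ) : Set where
  ▽    : 𝓛* n
  [_]  : (G : DeadEndB n) → ¬ (game G ≡ᵍ 𝟘) → 𝓛* n

_≈*_ : ∀ {n} → 𝓛* n → 𝓛* n → Set
▽       ≈* ▽       = ⊤
▽       ≈* [ _ ] _ = ⊥
[ _ ] _ ≈* ▽       = ⊥
[ G ] _ ≈* [ H ] _ = game G ≡ᵍ game H

_≤*_ : ∀ {n} → 𝓛* n → 𝓛* n → Set
_       ≤* ▽       = ⊤
▽       ≤* [ _ ] _ = ⊥
[ G ] _ ≤* [ H ] _ = game H ≥ game G

module Submission where

-- For Left dead-ends the misère order is combinatorial: G ≥ H iff G ≽ H, where G ≽ H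
-- means that H has no Right option when G has none and that every Right option of G
-- is ≽ some Right option of H.  Soundness is an induction on G and the summand X;
-- conversely, when G ⋡ H one builds a summand X such that Right, moving first, wins
-- G + X but loses H + X.  In particular 0 is comparable only with itself.  On the
-- nonzero classes the meet of G and H has as Right options those of G and of H, and
-- the join has as Right options the joins of a Right option of G with one of H (it is
-- ▽ when there are none); neither raises the height, so both stay within birthday n.
-- Distributivity holds because every Right option of (X ∧ Y) ∨ (X ∧ Z) dominates a
-- Right option of X or is a Right option of Y ∨ Z.

open import Defs
open import Algebra.Core using (Op₂)
open import Relation.Binary.Lattice.Structures using (IsDistributiveLattice; IsLattice)
open import Relation.Binary.Structures using (IsPartialOrder)
open import Data.Bool using (Bool; true; false)
open import Data.Bool.Properties using (∨-zeroʳ)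
open import Data.Empty using (⊥-elim)
open import Data.Fin using (Fin; zero; suc; splitAt; _↑ˡ_; _↑ʳ_)
open import Data.Fin.Properties using (splitAt-↑ˡ; splitAt-↑ʳ; all?; any?; ¬∀⟶∃¬; ¬Fin0)
open import Data.List using (List; []; _∷_; length; lookup; allFin; cartesianProduct; mapMaybe)
open import Data.List.Membership.Propositional using (_∈_; lose)
open import Data.List.Membership.Propositional.Properties
  using (∈-lookup; ∈-allFin; ∈-cartesianProduct⁺)
open import Data.List.Relation.Unary.All as All using (All; []; _∷_)
import Data.List.Relation.Unary.All.Properties as All
open import Data.List.Relation.Unary.Any as Any using (Any)
import Data.List.Relation.Unary.Any.Properties as Any
open import Data.Maybe using (Maybe; just; nothing; maybe)
import Data.Maybe.Relation.Unary.All as Maybe using (All; just; nothing; map; zip)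
import Data.Maybe.Relation.Unary.Any as Maybe using (Any; just)
open Maybe.All using (just; nothing)
open Maybe.Any using (just)
open import Data.Nat using (ℕ; zero; suc; _≤_; _<_; z≤n; s≤s; s≤s⁻¹)
open import Data.Nat.Base using () renaming (_+_ to _+ℕ_)
open import Data.Nat.Properties
  using (_≟_; ≤-trans; <-≤-trans; m≤m⊔n; m≤n⊔m; ⊔-lub; m+n≡0⇒m≡0; m+n≡0⇒n≡0)
open import Data.Product using (Σ; ∃-syntax; _×_; _,_; proj₁; proj₂; uncurry)
open import Data.Sum using (_⊎_; inj₁; inj₂)
open import Data.Unit using (tt)
open import Function using (_∘_)
open import Relation.Binary.PropositionalEquality
  using (_≡_; _≢_; refl; sym; trans; cong; cong₂; subst)
open import Relation.Nullary using (¬_; Dec; yes; no)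
open import Relation.Nullary.Decidable using (_×-dec_; _→-dec_; map′; decidable-stable)

-- Outcomes of sums

nL nR : Game → ℕ
nL ⟨ a , _ ∣ _ , _ ⟩ = a
nR ⟨ _ , _ ∣ b , _ ⟩ = b

optL : (G : Game) → Fin (nL G) → Game
optL ⟨ _ , f ∣ _ , _ ⟩ = f

optR : (G : Game) → Fin (nR G) → Game
optR ⟨ _ , _ ∣ _ , g ⟩ = g

anyFin≡true : ∀ n (p : Fin n → Bool) i → p i ≡ true → anyFin n p ≡ true
anyFin≡true (suc n) p zero    pᵢ rewrite pᵢ = refl
anyFin≡true (suc n) p (suc i) pᵢ
  rewrite anyFin≡true n (p ∘ suc) i pᵢ = ∨-zeroʳ (p zero)

anyFin≡false : ∀ n (p : Fin n → Bool) → (∀ i → p i ≡ false) → anyFin n p ≡ false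
anyFin≡false zero    p _ = refl
anyFin≡false (suc n) p h rewrite h zero = anyFin≡false n (p ∘ suc) (h ∘ suc)

𝓡≢𝓛 : 𝓡 ≢ 𝓛
𝓡≢𝓛 ()

≢𝓛⇒≡𝓡 : ∀ {p} → p ≢ 𝓛 → p ≡ 𝓡
≢𝓛⇒≡𝓡 {𝓛} p≢𝓛 = ⊥-elim (p≢𝓛 refl)
≢𝓛⇒≡𝓡 {𝓡} _   = refl

_≟𝓛 : ∀ p → Dec (p ≡ 𝓛)
𝓛 ≟𝓛 = yes refl
𝓡 ≟𝓛 = no 𝓡≢𝓛

oL-𝓛 : ∀ G i → oR (optL G i) ≡ 𝓛 → oL G ≡ 𝓛
oL-𝓛 ⟨ a , f ∣ _ , _ ⟩ i win
  rewrite anyFin≡true a (λ i → isL (oR (f i))) i (cong isL win) | ∨-zeroʳ (isZero a) = refl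

oR-𝓡 : ∀ G j → oL (optR G j) ≡ 𝓡 → oR G ≡ 𝓡
oR-𝓡 ⟨ _ , _ ∣ b , g ⟩ j lose
  rewrite anyFin≡true b (λ j → isR (oL (g j))) j (cong isR lose) | ∨-zeroʳ (isZero b) = refl

oL-𝓡 : ∀ G → nL G ≢ 0 → (∀ i → oR (optL G i) ≡ 𝓡) → oL G ≡ 𝓡
oL-𝓡 ⟨ zero  , _ ∣ _ , _ ⟩ a≢0 _ = ⊥-elim (a≢0 refl)
oL-𝓡 ⟨ suc a , f ∣ _ , _ ⟩ _ lose
  rewrite anyFin≡false (suc a) (λ i → isL (oR (f i))) (cong isL ∘ lose) = refl

oR-𝓛 : ∀ G → nR G ≢ 0 → (∀ j → oL (optR G j) ≡ 𝓛) → oR G ≡ 𝓛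
oR-𝓛 ⟨ _ , _ ∣ zero  , _ ⟩ b≢0 _ = ⊥-elim (b≢0 refl)
oR-𝓛 ⟨ _ , _ ∣ suc b , g ⟩ _ win
  rewrite anyFin≡false (suc b) (λ j → isR (oL (g j))) (cong isR ∘ win) = refl

oL-𝓛-elim : ∀ G → oL G ≡ 𝓛 → nL G ≡ 0 ⊎ ∃[ i ] oR (optL G i) ≡ 𝓛
oL-𝓛-elim G@(⟨ zero  , _ ∣ _ , _ ⟩) _ = inj₁ refl
oL-𝓛-elim G@(⟨ suc _ , f ∣ _ , _ ⟩) win with any? (λ i → oR (f i) ≟𝓛)
... | yes found = inj₂ found
... | no none   = ⊥-elim (𝓡≢𝓛 (trans (sym (oL-𝓡 G (λ ()) λ i → ≢𝓛⇒≡𝓡 λ wᵢ → none (i , wᵢ))) win))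

oR-𝓛-elim : ∀ G → oR G ≡ 𝓛 → nR G ≢ 0 × (∀ j → oL (optR G j) ≡ 𝓛)
oR-𝓛-elim ⟨ _ , _ ∣ zero  , _ ⟩ ()
oR-𝓛-elim G@(⟨ _ , _ ∣ suc _ , _ ⟩) win = (λ ()) , winⱼ
  where
  winⱼ : ∀ j → oL (optR G j) ≡ 𝓛
  winⱼ j with oL (optR G j) ≟𝓛
  ... | yes w = w
  ... | no ¬w = ⊥-elim (𝓡≢𝓛 (trans (sym (oR-𝓡 G j (≢𝓛⇒≡𝓡 ¬w))) win))

outcomeOf-mono : ∀ p q p′ q′ → (p′ ≡ 𝓛 → p ≡ 𝓛) → (q′ ≡ 𝓛 → q ≡ 𝓛) →
                 outcomeOf p q ≥ₒ outcomeOf p′ q′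
outcomeOf-mono 𝓛 𝓛 _ _ _ _ = tt
outcomeOf-mono 𝓛 𝓡 𝓛 𝓡 _ _ = tt
outcomeOf-mono 𝓛 𝓡 𝓡 𝓡 _ _ = tt
outcomeOf-mono 𝓡 𝓛 𝓡 𝓛 _ _ = tt
outcomeOf-mono 𝓡 𝓛 𝓡 𝓡 _ _ = tt
outcomeOf-mono 𝓡 𝓡 𝓡 𝓡 _ _ = tt
outcomeOf-mono _ 𝓡 _ 𝓛 _ q≤ = ⊥-elim (𝓡≢𝓛 (q≤ refl))
outcomeOf-mono 𝓡 _ 𝓛 _ p≤ _ = ⊥-elim (𝓡≢𝓛 (p≤ refl))

outcomeOf-monoʳ : ∀ p q p′ q′ → outcomeOf p q ≥ₒ outcomeOf p′ q′ → q′ ≡ 𝓛 → q ≡ 𝓛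
outcomeOf-monoʳ _ 𝓛 _ _  _ _ = refl
outcomeOf-monoʳ 𝓛 𝓡 𝓛 𝓛 () _
outcomeOf-monoʳ 𝓛 𝓡 𝓡 𝓛 () _
outcomeOf-monoʳ 𝓡 𝓡 𝓛 𝓛 () _
outcomeOf-monoʳ 𝓡 𝓡 𝓡 𝓛 () _

≥ₒ-refl : ∀ x → x ≥ₒ x
≥ₒ-refl L = tt
≥ₒ-refl N = tt
≥ₒ-refl P = tt
≥ₒ-refl R = tt

≥ₒ-trans : ∀ x y z → x ≥ₒ y → y ≥ₒ z → x ≥ₒ z
≥ₒ-trans L _ _ _ _ = tt
≥ₒ-trans N N N _ _ = tt
≥ₒ-trans N N R _ _ = tt
≥ₒ-trans N R R _ _ = tt
≥ₒ-trans P P P _ _ = tt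
≥ₒ-trans P P R _ _ = tt
≥ₒ-trans P R R _ _ = tt
≥ₒ-trans R R R _ _ = tt

≥-refl : ∀ G → G ≥ G
≥-refl G X = ≥ₒ-refl (o (G + X))

≥-trans : ∀ G H K → G ≥ H → H ≥ K → G ≥ K
≥-trans G H K G≥H H≥K X = ≥ₒ-trans (o (G + X)) (o (H + X)) (o (K + X)) (G≥H X) (H≥K X)

⊕-↑ˡ : ∀ {a c} {A : Set} (f : Fin a → A) (h : Fin c → A) i → (f ⊕ h) (i ↑ˡ c) ≡ f i
⊕-↑ˡ {a} {c} f h i rewrite splitAt-↑ˡ a i c = refl

⊕-↑ʳ : ∀ {a c} {A : Set} (f : Fin a → A) (h : Fin c → A) i → (f ⊕ h) (a ↑ʳ i) ≡ h i
⊕-↑ʳ {a} {c} f h i rewrite splitAt-↑ʳ a c i = refl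

module _ {a c} {A : Set} (P : A → Set) {f : Fin a → A} {h : Fin c → A} where

  all-⊕ : (∀ i → P (f i)) → (∀ i → P (h i)) → ∀ i → P ((f ⊕ h) i)
  all-⊕ pf ph i with splitAt a i
  ... | inj₁ i′ = pf i′
  ... | inj₂ i′ = ph i′

  all-⊕⁻ : (∀ i → P ((f ⊕ h) i)) → (∀ i → P (f i)) × (∀ i → P (h i))
  all-⊕⁻ p = (λ i → subst P (⊕-↑ˡ f h i) (p (i ↑ˡ c))) , (λ i → subst P (⊕-↑ʳ f h i) (p (a ↑ʳ i)))

-- Domination of Left dead-ends

infix 4 _≽_ _≽ᴿ_

data _≽_ : Game → Game → Set where
  ≽-intro : ∀ {a f b g H} → (b ≡ 0 → nR H ≡ 0) → (∀ i → ∃[ j ] g i ≽ optR H j) →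
            ⟨ a , f ∣ b , g ⟩ ≽ H

_≽ᴿ_ : Game → Game → Set
x ≽ᴿ H = ∃[ j ] x ≽ optR H j

≽-optR : ∀ {G H} → G ≽ H → ∀ i → optR G i ≽ᴿ H
≽-optR (≽-intro _ dom) = dom

≽-zeroˡ : ∀ {G H} → G ≽ H → nR G ≡ 0 → nR H ≡ 0
≽-zeroˡ (≽-intro z⇒z _) = z⇒z

≽-zeroʳ : ∀ {G H} → G ≽ H → nR H ≡ 0 → nR G ≡ 0
≽-zeroʳ (≽-intro {b = zero}  _ _)   _   = refl
≽-zeroʳ (≽-intro {b = suc _} _ dom) H≡0 = ⊥-elim (¬Fin0 (subst Fin H≡0 (proj₁ (dom zero))))

≽-refl : ∀ G → G ≽ G
≽-refl ⟨ _ , _ ∣ _ , g ⟩ = ≽-intro (λ b≡0 → b≡0) λ i → i , ≽-refl (g i)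

≽-noRight : ∀ {G H} → nR G ≡ 0 → nR H ≡ 0 → G ≽ H
≽-noRight {⟨ _ , _ ∣ zero , _ ⟩} _ H≡0 = ≽-intro (λ _ → H≡0) λ ()

_≽?_ : ∀ G H → Dec (G ≽ H)
⟨ _ , _ ∣ b , g ⟩ ≽? H =
  map′ (uncurry ≽-intro) (λ { (≽-intro z⇒z dom) → z⇒z , dom })
    (((b ≟ 0) →-dec (nR H ≟ 0)) ×-dec all? λ i → any? λ j → g i ≽? optR H j)

mutual
  ≽⇒oL : ∀ {G H} → LeftDeadEnd G → LeftDeadEnd H → G ≽ H →
         ∀ X → oL (H + X) ≡ 𝓛 → oL (G + X) ≡ 𝓛
  ≽⇒oL {G} {H} dG@(deadEnd _) dH@(deadEnd _) G≽H X@(⟨ _ , h ∣ _ , _ ⟩) win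
    with oL-𝓛-elim (H + X) win
  ... | inj₁ refl        = refl
  ... | inj₂ (i , winᵢ) = oL-𝓛 (G + X) i (≽⇒oR dG dH G≽H (h i) winᵢ)

  ≽⇒oR : ∀ {G H} → LeftDeadEnd G → LeftDeadEnd H → G ≽ H →
         ∀ X → oR (H + X) ≡ 𝓛 → oR (G + X) ≡ 𝓛
  ≽⇒oR {G@(⟨ 0 , _ ∣ b , g ⟩)} {H@(⟨ 0 , _ ∣ _ , k ⟩)} dG@(deadEnd dg) dH@(deadEnd dk) G≽H@(≽-intro b≡0⇒d≡0 dom)
       X@(⟨ _ , _ ∣ c , l ⟩) win =
    oR-𝓛 (G + X) hasRight (all-⊕ (λ Y → oL Y ≡ 𝓛)
      (λ i → ≽⇒oL (dg i) (dk (proj₁ (dom i))) (proj₂ (dom i)) X (proj₁ win⁻ (proj₁ (dom i))))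
      (λ j → ≽⇒oL dG dH G≽H (l j) (proj₂ win⁻ j)))
    where
    win⁻ : (∀ j → oL (k j + X) ≡ 𝓛) × (∀ j → oL (H + l j) ≡ 𝓛)
    win⁻ = all-⊕⁻ (λ Y → oL Y ≡ 𝓛) (proj₂ (oR-𝓛-elim (H + X) win))
    hasRight : b +ℕ c ≢ 0
    hasRight b+c≡0 = proj₁ (oR-𝓛-elim (H + X) win)
      (cong₂ _+ℕ_ (b≡0⇒d≡0 (m+n≡0⇒m≡0 b b+c≡0)) (m+n≡0⇒n≡0 b b+c≡0))

≽⇒≥ : ∀ {G H} → LeftDeadEnd G → LeftDeadEnd H → G ≽ H → G ≥ H
≽⇒≥ dG dH G≽H X = outcomeOf-mono _ _ _ _ (≽⇒oL dG dH G≽H X) (≽⇒oR dG dH G≽H X)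

⟪_⟫ : Game → Game
⟪ Y ⟫ = ⟨ 1 , (λ _ → Y) ∣ 1 , (λ _ → 𝟘) ⟩

oL-+𝟘 : ∀ {K} → LeftDeadEnd K → oL (K + 𝟘) ≡ 𝓛
oL-+𝟘 (deadEnd _) = refl

oL-+-𝓛 : ∀ {K a b f g} → LeftDeadEnd K → ∀ i → oR (K + f i) ≡ 𝓛 →
         oL (K + ⟨ a , f ∣ b , g ⟩) ≡ 𝓛
oL-+-𝓛 {K} {a} {b} {f} {g} (deadEnd _) = oL-𝓛 (K + ⟨ a , f ∣ b , g ⟩)

oL-+-𝓡 : ∀ {K a b f g} → LeftDeadEnd K → (∀ i → oR (K + f i) ≡ 𝓡) →
         oL (K + ⟨ suc a , f ∣ b , g ⟩) ≡ 𝓡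
oL-+-𝓡 {K} {a} {b} {f} {g} (deadEnd _) = oL-𝓡 (K + ⟨ suc a , f ∣ b , g ⟩) (λ ())

rightWinnable : ∀ {K} → LeftDeadEnd K → ∃[ Y ] oR (K + Y) ≡ 𝓡
rightWinnable {⟨ 0 , _ ∣ zero  , _ ⟩} _ = 𝟘 , refl
rightWinnable {K@(⟨ 0 , _ ∣ suc _ , _ ⟩)} (deadEnd dk) =
  let (Y , lose) = rightWinnable (dk zero) in
  ⟪ Y ⟫ , oR-𝓡 (K + ⟪ Y ⟫) zero (oL-+-𝓡 (dk zero) λ { zero → lose })

distinguish : ∀ {G H} → LeftDeadEnd G → LeftDeadEnd H → ¬ G ≽ H →
              ∃[ Y ] oR (H + Y) ≡ 𝓛 × oR (G + Y) ≡ 𝓡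
distinguish {⟨ 0 , _ ∣ zero , _ ⟩} {⟨ 0 , _ ∣ zero , _ ⟩} _ _ G⋡H =
  ⊥-elim (G⋡H (≽-intro (λ _ → refl) λ ()))
distinguish {⟨ 0 , _ ∣ zero , _ ⟩} {H@(⟨ 0 , _ ∣ suc _ , _ ⟩)} _ (deadEnd dk) _ =
  𝟘 , oR-𝓛 (H + 𝟘) (λ ()) (all-⊕ (λ Y → oL Y ≡ 𝓛) (oL-+𝟘 ∘ dk) λ ()) , refl
distinguish {G@(⟨ 0 , _ ∣ suc _ , _ ⟩)} {H@(⟨ 0 , _ ∣ zero , _ ⟩)} (deadEnd dg) dH _ =
  let (Y , lose) = rightWinnable (dg zero) in
  ⟪ Y ⟫ , oR-𝓛 (H + ⟪ Y ⟫) (λ ()) (λ { zero → oL-+𝟘 dH })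
        , oR-𝓡 (G + ⟪ Y ⟫) zero (oL-+-𝓡 (dg zero) λ { zero → lose })
-- Y = { Y₀ , … , Y_d | · } with Yⱼ distinguishing gᵢ from kⱼ: Right's move to gᵢ + Y
-- leaves Left only the moves to gᵢ + Yⱼ, which Right wins, whereas Left answers
-- Right's move to kⱼ + Y by moving to kⱼ + Yⱼ.
distinguish {G@(⟨ 0 , _ ∣ suc b , g ⟩)} {H@(⟨ 0 , _ ∣ suc d , k ⟩)} (deadEnd dg) (deadEnd dk) G⋡H =
  Y , oR-𝓛 (H + Y) (λ ())
        (all-⊕ (λ Z → oL Z ≡ 𝓛) (λ j → oL-+-𝓛 (dk j) j (proj₁ (proj₂ (sep j)))) λ ())
    , oR-𝓡 (G + Y) (i ↑ˡ 0) (subst (λ Z → oL Z ≡ 𝓡) (sym (⊕-↑ˡ _ _ i))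
        (oL-+-𝓡 (dg i) (λ j → proj₂ (proj₂ (sep j)))))
  where
  witness : ∃[ i ] ¬ g i ≽ᴿ H
  witness = ¬∀⟶∃¬ (suc b) (λ i → g i ≽ᴿ H) (λ i → any? λ j → g i ≽? optR H j) (G⋡H ∘ ≽-intro (λ ()))
  i : Fin (suc b)
  i = proj₁ witness
  sep : ∀ j → ∃[ Y ] oR (k j + Y) ≡ 𝓛 × oR (g i + Y) ≡ 𝓡
  sep j = distinguish (dg i) (dk j) (λ gᵢ≽kⱼ → proj₂ witness (j , gᵢ≽kⱼ))
  Y : Game
  Y = ⟨ suc d , proj₁ ∘ sep ∣ 0 , (λ ()) ⟩

≥⇒≽ : ∀ {G H} → LeftDeadEnd G → LeftDeadEnd H → G ≥ H → G ≽ H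
≥⇒≽ {G} {H} dG dH G≥H = decidable-stable (G ≽? H) λ G⋡H →
  let (Y , win , lose) = distinguish dG dH G⋡H in
  𝓡≢𝓛 (trans (sym lose) (outcomeOf-monoʳ _ _ _ _ (G≥H Y) win))

𝟘-deadEnd : LeftDeadEnd 𝟘
𝟘-deadEnd = deadEnd λ ()

nR≡0⇒≡ᵍ𝟘 : ∀ {K} → LeftDeadEnd K → nR K ≡ 0 → K ≡ᵍ 𝟘
nR≡0⇒≡ᵍ𝟘 dK K≡0 = ≽⇒≥ dK 𝟘-deadEnd (≽-noRight K≡0 refl) , ≽⇒≥ 𝟘-deadEnd dK (≽-noRight refl K≡0)

≡ᵍ𝟘⇒nR≡0 : ∀ {K} → LeftDeadEnd K → K ≡ᵍ 𝟘 → nR K ≡ 0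
≡ᵍ𝟘⇒nR≡0 dK (_ , 𝟘≥K) = ≽-zeroˡ (≥⇒≽ 𝟘-deadEnd dK 𝟘≥K) refl

-- Meets and joins of Left dead-ends

infix 4 _⊆ᴿ_
record _⊆ᴿ_ (G H : Game) : Set where
  constructor ⊆ᴿ-intro
  field embed : ∀ i → ∃[ j ] optR H j ≡ optR G i

≽ᴿ-mono : ∀ {x G H} → G ⊆ᴿ H → x ≽ᴿ G → x ≽ᴿ H
≽ᴿ-mono {x} (⊆ᴿ-intro embed) (i , x≽Gᵢ) = let (j , Hⱼ≡Gᵢ) = embed i in j , subst (x ≽_) (sym Hⱼ≡Gᵢ) x≽Gᵢ

⊆ᴿ⇒≽ : ∀ {G H} → nR G ≢ 0 → G ⊆ᴿ H → G ≽ H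
⊆ᴿ⇒≽ {G@(⟨ _ , _ ∣ _ , g ⟩)} {H} G≢0 G⊆H = ≽-intro (⊥-elim ∘ G≢0) λ i → ≽ᴿ-mono G⊆H (i , ≽-refl (g i))

⊆ᴿ-refl : ∀ G → G ⊆ᴿ G
⊆ᴿ-refl _ = ⊆ᴿ-intro λ i → i , refl

maxFin-ub : ∀ n (h : Fin n → ℕ) i → h i ≤ maxFin n h
maxFin-ub (suc n) h zero    = m≤m⊔n _ _
maxFin-ub (suc n) h (suc i) = ≤-trans (maxFin-ub n (h ∘ suc) i) (m≤n⊔m _ _)

maxFin-lub : ∀ n (h : Fin n → ℕ) {m} → (∀ i → h i ≤ m) → maxFin n h ≤ m
maxFin-lub zero    h _ = z≤n
maxFin-lub (suc n) h h≤ = ⊔-lub (h≤ zero) (maxFin-lub n (h ∘ suc) (h≤ ∘ suc))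

height-optR : ∀ G j → height (optR G j) < height G
height-optR ⟨ zero  , _ ∣ suc b , g ⟩ j = s≤s (maxFin-ub (suc b) (height ∘ g) j)
height-optR ⟨ suc a , f ∣ suc b , g ⟩ j =
  s≤s (≤-trans (maxFin-ub (suc b) (height ∘ g) j) (m≤n⊔m (maxFin (suc a) (height ∘ f)) _))

height-lub : ∀ {b f g m} → (∀ j → height (g j) < m) → height ⟨ 0 , f ∣ b , g ⟩ ≤ m
height-lub {zero}                     _ = z≤n
height-lub {suc b} {g = g} {m = suc m} h< = s≤s (maxFin-lub (suc b) (height ∘ g) (s≤s⁻¹ ∘ h<))
height-lub {suc b}         {m = zero}  h< with () ← h< zero

⟨∣_⟩ : List Game → Game
⟨∣ xs ⟩ = ⟨ 0 , (λ ()) ∣ length xs , lookup xs ⟩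

⟨∣_⟩? : List Game → Maybe Game
⟨∣ [] ⟩?          = nothing
⟨∣ xs@(_ ∷ _) ⟩? = just ⟨∣ xs ⟩

collect : ∀ {b d} {A : Set} → (Fin b → Fin d → Maybe A) → List A
collect {b} {d} m = mapMaybe (uncurry m) (cartesianProduct (allFin b) (allFin d))

module _ {b d} {A : Set} {m : Fin b → Fin d → Maybe A} where

  collect-all : ∀ {P : A → Set} → (∀ i j → Maybe.All P (m i j)) → All P (collect m)
  collect-all h =
    All.mapMaybe⁺ {xs = cartesianProduct (allFin b) (allFin d)} (All.map⁺ (All.universal (uncurry h) _))

  collect-any : ∀ {P : A → Set} i j → Maybe.Any P (m i j) → Any P (collect m)
  collect-any i j p =
    Any.mapMaybe⁺ _ _ (Any.map⁺ (lose (∈-cartesianProduct⁺ (∈-allFin i) (∈-allFin j)) p))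

  ∈-collect : ∀ i j → Maybe.All (_∈ collect m) (m i j)
  ∈-collect i j with m i j in eq
  ... | nothing = nothing
  ... | just x  = just (collect-any i j (subst (Maybe.Any (x ≡_)) (sym eq) (just refl)))

⟨∣⟩?-all : ∀ {Q P : Game → Set} {xs} → All Q xs →
           (∀ {y ys} → All Q (y ∷ ys) → P ⟨∣ y ∷ ys ⟩) → Maybe.All P ⟨∣ xs ⟩?
⟨∣⟩?-all []         _ = nothing
⟨∣⟩?-all qs@(_ ∷ _) h = just (h qs)

⟨∣⟩?-any : ∀ {Q P : Game → Set} {xs} → Any Q xs → P ⟨∣ xs ⟩ → Maybe.Any P ⟨∣ xs ⟩?
⟨∣⟩?-any (Any.here _)  p = just p
⟨∣⟩?-any (Any.there _) p = just p

⟨∣⟩?-nonzero : ∀ xs → Maybe.All (λ M → nR M ≢ 0) ⟨∣ xs ⟩?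
⟨∣⟩?-nonzero []      = nothing
⟨∣⟩?-nonzero (_ ∷ _) = just λ ()

height-⟨∣⟩ : ∀ {m} xs → All (λ x → height x < m) xs → height ⟨∣ xs ⟩ ≤ m
height-⟨∣⟩ xs hs = height-lub {length xs} (All.lookup hs ∘ ∈-lookup)

⟨∣∷⟩-≽ : ∀ {H y ys} → All (_≽ᴿ H) (y ∷ ys) → ⟨∣ y ∷ ys ⟩ ≽ H
⟨∣∷⟩-≽ qs = ≽-intro (λ ()) (All.lookup qs ∘ ∈-lookup)

any⇒≽ᴿ⟨∣⟩ : ∀ {x xs} → Any (x ≽_) xs → x ≽ᴿ ⟨∣ xs ⟩
any⇒≽ᴿ⟨∣⟩ p = Any.index p , Any.lookup-index p

infixl 7 _⊓_
infixl 6 _⊔?_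

_⊓_ : Game → Game → Game
⟨ _ , _ ∣ b , g ⟩ ⊓ ⟨ _ , _ ∣ d , k ⟩ = ⟨ 0 , (λ ()) ∣ b +ℕ d , g ⊕ k ⟩

-- nothing stands for ▽: by ⊔?-least, no game dominates both arguments.
_⊔?_ : Game → Game → Maybe Game
⟨ _ , _ ∣ zero  , _ ⟩ ⊔? ⟨ _ , _ ∣ zero  , _ ⟩ = just 𝟘
⟨ _ , _ ∣ zero  , _ ⟩ ⊔? ⟨ _ , _ ∣ suc _ , _ ⟩ = nothing
⟨ _ , _ ∣ suc _ , _ ⟩ ⊔? ⟨ _ , _ ∣ zero  , _ ⟩ = nothing
⟨ _ , _ ∣ suc _ , g ⟩ ⊔? ⟨ _ , _ ∣ suc _ , k ⟩ = ⟨∣ collect (λ i j → g i ⊔? k j) ⟩?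

⊆ᴿ-⊓ˡ : ∀ G H → G ⊆ᴿ G ⊓ H
⊆ᴿ-⊓ˡ ⟨ _ , _ ∣ _ , g ⟩ ⟨ _ , _ ∣ d , k ⟩ = ⊆ᴿ-intro λ i → i ↑ˡ d , ⊕-↑ˡ g k i

⊆ᴿ-⊓ʳ : ∀ G H → H ⊆ᴿ G ⊓ H
⊆ᴿ-⊓ʳ ⟨ _ , _ ∣ b , g ⟩ ⟨ _ , _ ∣ _ , k ⟩ = ⊆ᴿ-intro λ j → b ↑ʳ j , ⊕-↑ʳ g k j

⊓-greatest : ∀ {G H Z} → G ≽ Z → H ≽ Z → G ⊓ H ≽ Z
⊓-greatest {⟨ _ , _ ∣ b , _ ⟩} {⟨ _ , _ ∣ _ , _ ⟩} {Z} G≽Z H≽Z =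
  ≽-intro (≽-zeroˡ G≽Z ∘ m+n≡0⇒m≡0 b) (all-⊕ (_≽ᴿ Z) (≽-optR G≽Z) (≽-optR H≽Z))

⊓-deadEnd : ∀ {G H} → LeftDeadEnd G → LeftDeadEnd H → LeftDeadEnd (G ⊓ H)
⊓-deadEnd (deadEnd dg) (deadEnd dk) = deadEnd (all-⊕ LeftDeadEnd dg dk)

⊓-height : ∀ {m} G H → height G ≤ m → height H ≤ m → height (G ⊓ H) ≤ m
⊓-height {m} G@(⟨ _ , _ ∣ _ , _ ⟩) H@(⟨ _ , _ ∣ _ , _ ⟩) G≤ H≤ =
  height-lub (all-⊕ (λ x → height x < m)
    (λ i → <-≤-trans (height-optR G i) G≤) (λ j → <-≤-trans (height-optR H j) H≤))

⊓-nonzero : ∀ G H → nR G ≢ 0 → nR (G ⊓ H) ≢ 0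
⊓-nonzero ⟨ _ , _ ∣ b , _ ⟩ ⟨ _ , _ ∣ _ , _ ⟩ b≢0 = b≢0 ∘ m+n≡0⇒m≡0 b

⊔?-upper : ∀ G H → Maybe.All (λ M → M ≽ G × M ≽ H) (G ⊔? H)
⊔?-upper ⟨ _ , _ ∣ zero  , _ ⟩ ⟨ _ , _ ∣ zero  , _ ⟩ = just (≽-noRight refl refl , ≽-noRight refl refl)
⊔?-upper ⟨ _ , _ ∣ zero  , _ ⟩ ⟨ _ , _ ∣ suc _ , _ ⟩ = nothing
⊔?-upper ⟨ _ , _ ∣ suc _ , _ ⟩ ⟨ _ , _ ∣ zero  , _ ⟩ = nothing
⊔?-upper ⟨ _ , _ ∣ suc _ , g ⟩ ⟨ _ , _ ∣ suc _ , k ⟩ =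
  ⟨∣⟩?-all
    (collect-all λ i j → Maybe.map (λ (≽gᵢ , ≽kⱼ) → (i , ≽gᵢ) , (j , ≽kⱼ)) (⊔?-upper (g i) (k j)))
    (λ qs → ⟨∣∷⟩-≽ (All.map proj₁ qs) , ⟨∣∷⟩-≽ (All.map proj₂ qs))

⊔?-least : ∀ {Z} G H → Z ≽ G → Z ≽ H → Maybe.Any (Z ≽_) (G ⊔? H)
⊔?-least ⟨ _ , _ ∣ zero  , _ ⟩ ⟨ _ , _ ∣ zero  , _ ⟩ Z≽G _ = just (≽-noRight (≽-zeroʳ Z≽G refl) refl)
⊔?-least ⟨ _ , _ ∣ zero  , _ ⟩ ⟨ _ , _ ∣ suc _ , _ ⟩ Z≽G Z≽H
  with () ← ≽-zeroˡ Z≽H (≽-zeroʳ Z≽G refl)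
⊔?-least ⟨ _ , _ ∣ suc _ , _ ⟩ ⟨ _ , _ ∣ zero  , _ ⟩ Z≽G Z≽H
  with () ← ≽-zeroˡ Z≽G (≽-zeroʳ Z≽H refl)
⊔?-least {⟨ _ , _ ∣ zero , _ ⟩} ⟨ _ , _ ∣ suc _ , _ ⟩ ⟨ _ , _ ∣ suc _ , _ ⟩ Z≽G _
  with () ← ≽-zeroˡ Z≽G refl
⊔?-least {Z@(⟨ _ , _ ∣ suc _ , _ ⟩)} ⟨ _ , _ ∣ suc _ , g ⟩ ⟨ _ , _ ∣ suc _ , k ⟩ Z≽G Z≽H =
  ⟨∣⟩?-any (joinsBelow zero) (≽-intro (λ ()) (any⇒≽ᴿ⟨∣⟩ ∘ joinsBelow))
  where
  joinsBelow : ∀ i → Any (optR Z i ≽_) (collect λ i j → g i ⊔? k j)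
  joinsBelow i =
    let (j , ≽gⱼ) = ≽-optR Z≽G i ; (j′ , ≽kⱼ′) = ≽-optR Z≽H i in
    collect-any {m = λ i j → g i ⊔? k j} j j′ (⊔?-least (g j) (k j′) ≽gⱼ ≽kⱼ′)

⊔?-deadEnd : ∀ G H → Maybe.All LeftDeadEnd (G ⊔? H)
⊔?-deadEnd ⟨ _ , _ ∣ zero  , _ ⟩ ⟨ _ , _ ∣ zero  , _ ⟩ = just (deadEnd λ ())
⊔?-deadEnd ⟨ _ , _ ∣ zero  , _ ⟩ ⟨ _ , _ ∣ suc _ , _ ⟩ = nothing
⊔?-deadEnd ⟨ _ , _ ∣ suc _ , _ ⟩ ⟨ _ , _ ∣ zero  , _ ⟩ = nothing
⊔?-deadEnd ⟨ _ , _ ∣ suc _ , g ⟩ ⟨ _ , _ ∣ suc _ , k ⟩ =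
  ⟨∣⟩?-all (collect-all λ i j → ⊔?-deadEnd (g i) (k j)) λ qs → deadEnd (All.lookup qs ∘ ∈-lookup)

⊔?-height : ∀ m G H → height G ≤ m → height H ≤ m → Maybe.All (λ M → height M ≤ m) (G ⊔? H)
⊔?-height m ⟨ _ , _ ∣ zero  , _ ⟩ ⟨ _ , _ ∣ zero  , _ ⟩ _ _ = just z≤n
⊔?-height m ⟨ _ , _ ∣ zero  , _ ⟩ ⟨ _ , _ ∣ suc _ , _ ⟩ _ _ = nothing
⊔?-height m ⟨ _ , _ ∣ suc _ , _ ⟩ ⟨ _ , _ ∣ zero  , _ ⟩ _ _ = nothing
⊔?-height zero G@(⟨ _ , _ ∣ suc _ , _ ⟩) ⟨ _ , _ ∣ suc _ , _ ⟩ G≤0 _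
  with () ← <-≤-trans (height-optR G zero) G≤0
⊔?-height (suc m) G@(⟨ _ , _ ∣ suc _ , g ⟩) H@(⟨ _ , _ ∣ suc _ , k ⟩) G≤ H≤ =
  ⟨∣⟩?-all (collect-all λ i j → Maybe.map s≤s (⊔?-height m (g i) (k j) (below G G≤ i) (below H H≤ j)))
    (height-⟨∣⟩ _)
  where
  below : ∀ K → height K ≤ suc m → ∀ j → height (optR K j) ≤ m
  below K K≤ j = s≤s⁻¹ (<-≤-trans (height-optR K j) K≤)

⊔?-nonzero : ∀ G H → nR G ≢ 0 → Maybe.All (λ M → nR M ≢ 0) (G ⊔? H)
⊔?-nonzero ⟨ _ , _ ∣ zero  , _ ⟩ _                       G≢0 = ⊥-elim (G≢0 refl)
⊔?-nonzero ⟨ _ , _ ∣ suc _ , _ ⟩ ⟨ _ , _ ∣ zero  , _ ⟩ _ = nothing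
⊔?-nonzero ⟨ _ , _ ∣ suc _ , _ ⟩ ⟨ _ , _ ∣ suc _ , _ ⟩ _ = ⟨∣⟩?-nonzero _

⊔?-optR : ∀ Y Z u v → Maybe.All (λ x → Maybe.Any (x ≽ᴿ_) (Y ⊔? Z)) (optR Y u ⊔? optR Z v)
⊔?-optR ⟨ _ , _ ∣ suc _ , k ⟩ ⟨ _ , _ ∣ suc _ , l ⟩ u v =
  Maybe.map (λ x∈ → ⟨∣⟩?-any x∈ (any⇒≽ᴿ⟨∣⟩ (Any.map (λ { refl → ≽-refl _ }) x∈)))
    (∈-collect {m = λ u v → k u ⊔? l v} u v)

⊓-⊔?-⊓-≽ : ∀ X Y Z {T} → nR X ≢ 0 → X ⊆ᴿ T →
           (∀ u v → Maybe.All (_≽ᴿ T) (optR Y u ⊔? optR Z v)) →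
           Maybe.All (_≽ T) (X ⊓ Y ⊔? X ⊓ Z)
⊓-⊔?-⊓-≽ ⟨ _ , _ ∣ zero , _ ⟩ _ _ X≢0 _ _ = ⊥-elim (X≢0 refl)
⊓-⊔?-⊓-≽ ⟨ _ , _ ∣ suc _ , g ⟩ ⟨ _ , _ ∣ _ , k ⟩ ⟨ _ , _ ∣ _ , l ⟩ {T} _ X⊆T joinsYZ =
  ⟨∣⟩?-all (collect-all (all-⊕ (λ x → ∀ j → Maybe.All (_≽ᴿ T) (x ⊔? (g ⊕ l) j)) {g} {k}
    (λ i j → Maybe.map (λ (≽gᵢ , _) → ≽ᴿ-mono X⊆T (i , ≽gᵢ)) (⊔?-upper (g i) ((g ⊕ l) j)))
    (λ u → all-⊕ (λ y → Maybe.All (_≽ᴿ T) (k u ⊔? y)) {g} {l}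
      (λ j → Maybe.map (λ (_ , ≽gⱼ) → ≽ᴿ-mono X⊆T (j , ≽gⱼ)) (⊔?-upper (k u) (g j)))
      (joinsYZ u))))
    ⟨∣∷⟩-≽

-- maybe (X ⊓_) X (Y ⊔? Z) represents x ∧* (y ∨* z), since x ∧* ▽ = x.
⊓-⊔?-distrib : ∀ X Y Z → nR X ≢ 0 → Maybe.All (_≽ maybe (X ⊓_) X (Y ⊔? Z)) (X ⊓ Y ⊔? X ⊓ Z)
⊓-⊔?-distrib X Y Z X≢0 =
  ⊓-⊔?-⊓-≽ X Y Z X≢0 (X⊆ (Y ⊔? Z)) λ u v → Maybe.map inT (⊔?-optR Y Z u v)
  where
  X⊆ : ∀ m → X ⊆ᴿ maybe (X ⊓_) X m
  X⊆ nothing  = ⊆ᴿ-refl X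
  X⊆ (just W) = ⊆ᴿ-⊓ˡ X W
  inT : ∀ {x m} → Maybe.Any (x ≽ᴿ_) m → x ≽ᴿ maybe (X ⊓_) X m
  inT {m = just W} (just x≽W) = ≽ᴿ-mono (⊆ᴿ-⊓ʳ X W) x≽W

-- The lattice 𝓛ₙ*

module _ {n : ℕ} where

  -- All computations happen on the representative of height ≤ n carried by the birthday witness.
  rep : DeadEndB n → Game
  rep X = proj₁ (birthday X)

  rep-deadEnd : ∀ X → LeftDeadEnd (rep X)
  rep-deadEnd X = proj₁ (proj₂ (birthday X))

  rep-≡ᵍ : ∀ X → rep X ≡ᵍ game X
  rep-≡ᵍ X = proj₁ (proj₂ (proj₂ (birthday X)))

  rep-height : ∀ X → height (rep X) ≤ n
  rep-height X = proj₂ (proj₂ (proj₂ (birthday X)))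

  rep-nonzero : ∀ X → ¬ game X ≡ᵍ 𝟘 → nR (rep X) ≢ 0
  rep-nonzero X X≢𝟘 X≡0 =
    let (X≥rep , rep≥X) = rep-≡ᵍ X ; (rep≥𝟘 , 𝟘≥rep) = nR≡0⇒≡ᵍ𝟘 (rep-deadEnd X) X≡0 in
    X≢𝟘 (≥-trans (game X) (rep X) 𝟘 rep≥X rep≥𝟘 , ≥-trans 𝟘 (rep X) (game X) 𝟘≥rep X≥rep)

  ≽⇒≥ᴰ : ∀ X Y → rep Y ≽ rep X → game Y ≥ game X
  ≽⇒≥ᴰ X Y Y≽X = ≥-trans (game Y) (rep Y) (game X) (proj₂ (rep-≡ᵍ Y))
    (≥-trans (rep Y) (rep X) (game X) (≽⇒≥ (rep-deadEnd Y) (rep-deadEnd X) Y≽X) (proj₁ (rep-≡ᵍ X)))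

  ≥⇒≽ᴰ : ∀ X Y → game Y ≥ game X → rep Y ≽ rep X
  ≥⇒≽ᴰ X Y Y≥X = ≥⇒≽ (rep-deadEnd Y) (rep-deadEnd X) (≥-trans (rep Y) (game Y) (rep X) (proj₁ (rep-≡ᵍ Y))
    (≥-trans (game Y) (game X) (rep X) Y≥X (proj₂ (rep-≡ᵍ X))))

  element : ∀ M → LeftDeadEnd M → height M ≤ n → DeadEndB n
  element M dM hM = elt M dM (M , dM , (≥-refl M , ≥-refl M) , hM)

  _⊓ᴰ_ : DeadEndB n → DeadEndB n → DeadEndB n
  X ⊓ᴰ Y = element (rep X ⊓ rep Y) (⊓-deadEnd (rep-deadEnd X) (rep-deadEnd Y))
             (⊓-height (rep X) (rep Y) (rep-height X) (rep-height Y))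

  Represents : Game → Set
  Represents M = LeftDeadEnd M × height M ≤ n × nR M ≢ 0

  fromMaybe : (m : Maybe Game) → Maybe.All Represents m → 𝓛* n
  fromMaybe nothing  _                       = ▽
  fromMaybe (just M) (just (dM , hM , M≢0)) = [ element M dM hM ] (M≢0 ∘ ≡ᵍ𝟘⇒nR≡0 dM)

  infixr 6 _∨*_
  infixr 7 _∧*_

  _∨*_ : Op₂ (𝓛* n)
  ▽       ∨* _       = ▽
  [ _ ] _ ∨* ▽       = ▽
  [ X ] p ∨* [ Y ] _ = fromMaybe (rep X ⊔? rep Y) (Maybe.zip (⊔?-deadEnd (rep X) (rep Y) , Maybe.zip
    (⊔?-height n (rep X) (rep Y) (rep-height X) (rep-height Y) , ⊔?-nonzero (rep X) (rep Y) (rep-nonzero X p))))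

  _∧*_ : Op₂ (𝓛* n)
  ▽       ∧* y       = y
  [ X ] p ∧* ▽       = [ X ] p
  [ X ] p ∧* [ Y ] _ =
    [ X ⊓ᴰ Y ] (⊓-nonzero (rep X) (rep Y) (rep-nonzero X p) ∘ ≡ᵍ𝟘⇒nR≡0 (rep-deadEnd (X ⊓ᴰ Y)))

  ≤*-refl : (x : 𝓛* n) → x ≤* x
  ≤*-refl ▽         = tt
  ≤*-refl ([ X ] _) = ≥-refl (game X)

  ≤*-trans : {x y z : 𝓛* n} → x ≤* y → y ≤* z → x ≤* z
  ≤*-trans {z = ▽}                         _   _   = tt
  ≤*-trans {▽}       {▽}       {[ _ ] _} _   ()
  ≤*-trans {[ _ ] _} {▽}       {[ _ ] _} _   ()
  ≤*-trans {[ X ] _} {[ Y ] _} {[ Z ] _} x≤y y≤z = ≥-trans (game Z) (game Y) (game X) y≤z x≤y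

  isPartialOrder : IsPartialOrder (_≈*_ {n}) (_≤*_ {n})
  isPartialOrder = record
    { isPreorder = record
      { isEquivalence = record
        { refl  = λ {x} → ≈*-refl x
        ; sym   = λ {x} {y} → ≈*-sym x y
        ; trans = λ {x} {y} {z} → ≈*-trans x y z
        }
      ; reflexive = λ {x} {y} → ≈*⇒≤* x y
      ; trans     = ≤*-trans
      }
    ; antisym = λ {x} {y} → ≤*-antisym x y
    }
    where
    ≈*-refl : (x : 𝓛* n) → x ≈* x
    ≈*-refl ▽         = tt
    ≈*-refl ([ X ] _) = ≥-refl (game X) , ≥-refl (game X)
    ≈*-sym : (x y : 𝓛* n) → x ≈* y → y ≈* x
    ≈*-sym ▽         ▽         _         = tt
    ≈*-sym ([ _ ] _) ([ _ ] _) (≥ , ≤) = ≤ , ≥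
    ≈*-trans : (x y z : 𝓛* n) → x ≈* y → y ≈* z → x ≈* z
    ≈*-trans ▽         ▽         ▽         _         _         = tt
    ≈*-trans ([ X ] _) ([ Y ] _) ([ Z ] _) (≥₁ , ≤₁) (≥₂ , ≤₂) =
      ≥-trans (game X) (game Y) (game Z) ≥₁ ≥₂ , ≥-trans (game Z) (game Y) (game X) ≤₂ ≤₁
    ≈*⇒≤* : (x y : 𝓛* n) → x ≈* y → x ≤* y
    ≈*⇒≤* ▽         ▽         _       = tt
    ≈*⇒≤* ([ _ ] _) ([ _ ] _) (_ , ≤) = ≤
    ≤*-antisym : (x y : 𝓛* n) → x ≤* y → y ≤* x → x ≈* y
    ≤*-antisym ▽         ▽         _   _   = tt
    ≤*-antisym ([ _ ] _) ([ _ ] _) x≤y y≤x = y≤x , x≤y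

  ≤*-fromMaybe : ∀ X p m r → Maybe.All (_≽ rep X) m → [ X ] p ≤* fromMaybe m r
  ≤*-fromMaybe X p nothing  _                    _          = tt
  ≤*-fromMaybe X p (just M) (just (dM , hM , _)) (just M≽X) = ≽⇒≥ᴰ X (element M dM hM) M≽X

  fromMaybe-≤* : ∀ Z p m r → Maybe.Any (rep Z ≽_) m → fromMaybe m r ≤* [ Z ] p
  fromMaybe-≤* Z p (just M) (just (dM , hM , _)) (just Z≽M) = ≽⇒≥ᴰ (element M dM hM) Z Z≽M

  supremum : ∀ (x y : 𝓛* n) → x ≤* (x ∨* y) × y ≤* (x ∨* y) × (∀ z → x ≤* z → y ≤* z → (x ∨* y) ≤* z)
  supremum ▽         _         = tt , tt , λ _ ▽≤z _ → ▽≤z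
  supremum ([ _ ] _) ▽         = tt , tt , λ _ _ ▽≤z → ▽≤z
  supremum ([ X ] p) ([ Y ] q) =
    ≤*-fromMaybe X p _ _ (Maybe.map proj₁ upper) , ≤*-fromMaybe Y q _ _ (Maybe.map proj₂ upper) , least
    where
    upper = ⊔?-upper (rep X) (rep Y)
    least : ∀ z → [ X ] p ≤* z → [ Y ] q ≤* z → ([ X ] p ∨* [ Y ] q) ≤* z
    least ▽         _   _   = tt
    least ([ Z ] r) X≤Z Y≤Z =
      fromMaybe-≤* Z r _ _ (⊔?-least (rep X) (rep Y) (≥⇒≽ᴰ X Z X≤Z) (≥⇒≽ᴰ Y Z Y≤Z))

  infimum : ∀ (x y : 𝓛* n) → (x ∧* y) ≤* x × (x ∧* y) ≤* y × (∀ z → z ≤* x → z ≤* y → z ≤* (x ∧* y))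
  infimum ▽           y         = tt , ≤*-refl y , λ _ _ z≤y → z≤y
  infimum x@([ _ ] _) ▽         = ≤*-refl x , tt , λ _ z≤x _ → z≤x
  infimum ([ X ] p)   ([ Y ] q) =
    ≽⇒≥ᴰ (X ⊓ᴰ Y) X (⊆ᴿ⇒≽ (rep-nonzero X p) (⊆ᴿ-⊓ˡ (rep X) (rep Y))) ,
    ≽⇒≥ᴰ (X ⊓ᴰ Y) Y (⊆ᴿ⇒≽ (rep-nonzero Y q) (⊆ᴿ-⊓ʳ (rep X) (rep Y))) , greatest
    where
    greatest : ∀ z → z ≤* [ X ] p → z ≤* [ Y ] q → z ≤* ([ X ] p ∧* [ Y ] q)
    greatest ([ Z ] _) Z≤X Z≤Y = ≽⇒≥ᴰ Z (X ⊓ᴰ Y) (⊓-greatest (≥⇒≽ᴰ Z X Z≤X) (≥⇒≽ᴰ Z Y Z≤Y))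

  isLattice : IsLattice (_≈*_ {n}) _≤*_ _∨*_ _∧*_
  isLattice = record { isPartialOrder = isPartialOrder ; supremum = supremum ; infimum = infimum }

  open IsLattice isLattice using (x≤x∨y; y≤x∨y; ∨-least; x∧y≤x; x∧y≤y; ∧-greatest; antisym)

  ∧*-fromMaybe-≤* : ∀ X p m r m′ r′ → Maybe.All (_≽ maybe (rep X ⊓_) (rep X) m) m′ →
                    ([ X ] p ∧* fromMaybe m r) ≤* fromMaybe m′ r′
  ∧*-fromMaybe-≤* X p _        _                    nothing  _                    _ = tt
  ∧*-fromMaybe-≤* X p nothing  _                    (just D) (just (dD , hD , _)) (just D≽X) =
    ≽⇒≥ᴰ X (element D dD hD) D≽X
  ∧*-fromMaybe-≤* X p (just W) (just (dW , hW , _)) (just D) (just (dD , hD , _)) (just D≽X⊓W) =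
    ≽⇒≥ᴰ (X ⊓ᴰ element W dW hW) (element D dD hD) D≽X⊓W

  ∧*-∨*-≤ : ∀ (x y z : 𝓛* n) → (x ∧* (y ∨* z)) ≤* (x ∧* y ∨* x ∧* z)
  ∧*-∨*-≤ ▽           y           z         = ≤*-refl (y ∨* z)
  ∧*-∨*-≤ x@([ _ ] _) ▽           z         = x≤x∨y x (x ∧* z)
  ∧*-∨*-≤ x@([ _ ] _) y@([ _ ] _) ▽         = y≤x∨y (x ∧* y) x
  ∧*-∨*-≤ ([ X ] p)   ([ Y ] _)   ([ Z ] _) =
    ∧*-fromMaybe-≤* X p (rep Y ⊔? rep Z) _ _ _ (⊓-⊔?-distrib (rep X) (rep Y) (rep Z) (rep-nonzero X p))

  ∧*-distribˡ-∨* : ∀ (x y z : 𝓛* n) → (x ∧* (y ∨* z)) ≈* (x ∧* y ∨* x ∧* z)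
  ∧*-distribˡ-∨* x y z = antisym (∧*-∨*-≤ x y z)
    (∨-least (∧-greatest (x∧y≤x x y) (≤*-trans (x∧y≤y x y) (x≤x∨y y z)))
             (∧-greatest (x∧y≤x x z) (≤*-trans (x∧y≤y x z) (y≤x∨y y z))))

theorem3p11 : (n : ℕ) →
    Σ (Op₂ (𝓛* n)) λ _∨_ → Σ (Op₂ (𝓛* n)) λ _∧_ →
      IsDistributiveLattice (_≈*_ {n}) (_≤*_ {n}) _∨_ _∧_
theorem3p11 n = _∨*_ , _∧*_ , record { isLattice = isLattice ; ∧-distribˡ-∨ = ∧*-distribˡ-∨* }
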